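{- For integers $m,n\ge 0$ let $$S_{m,n}=\frac{(2m)!\,(2n)!}{m!\,n!\,(m+n)!}$$ (the super Catalan numbers). For integers $m,k\ge 0$ let $L_{m,k}=\binom{2m}{m+k}$ (so $L_{m,k}=0$ when $k>m$), and let $D$ be the diagonal matrix indexed by $k\ge 0$ with $D_{0,0}=1$ and $D_{k,k}=(-1)^k\cdot 2$ for $k>0$. Then $S=LDL^{T}$, i.e. for all integers $m,n\ge 0$, $$S_{m,n}=\sum_{k\ge 0} L_{m,k}\,D_{k,k}\,L_{n,k}=\binom{2m}{m}\binom{2n}{n}+2\sum_{k>0}(-1)^k\binom{2m}{m+k}\binom{2n}{n+k},$$ where the sum is finite.
   Context: All matrices are indexed starting at $0$. Binomial coefficients $\binom{a}{b}$ are $0$ when $b>a$. -}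

module Defs where

open import Data.Nat using (ℕ; zero; suc; _+_; _*_; _!; NonZero)
open import Data.Nat.DivMod using (_/_)
open import Data.Nat.Combinatorics using (_C_)
open import Data.Nat.Properties using (m*n≢0; _!≢0)

open import Data.Integer using (ℤ; +_; -_; -1ℤ; _^_) renaming (_+_ to _+ℤ_; _*_ to _*ℤ_)

-- Super Catalan number S_{m,n} = (2m)! (2n)! / (m! n! (m+n)!)
-- (ℕ division; the quotient is exact, and the theorem below implies this)
S : ℕ → ℕ → ℕ
S m n = ((2 * m) ! * (2 * n) !) / (m ! * n ! * (m + n) !)
  where instance
    nz : NonZero (m ! * n ! * (m + n) !)
    nz = m*n≢0 (m ! * n !) ((m + n) !) {{m*n≢0 (m !) (n !) {{m !≢0}} {{n !≢0}}}} {{(m + n) !≢0}}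

-- L_{m,k} = binom(2m, m+k)  (stdlib's _C_ is 0 when m+k > 2m, i.e. k > m)
L : ℕ → ℕ → ℤ
L m k = + ((2 * m) C (m + k))

D : ℕ → ℤ
D zero = + 1
D (suc k) = (-1ℤ ^ suc k) *ℤ + 2

sumTo : ℕ → (ℕ → ℤ) → ℤ
sumTo zero f = + 0
sumTo (suc N) f = sumTo N f +ℤ f N

{-# OPTIONS --safe #-}
module Submission where

-- Both sides satisfy f(m,0) = C(2m,m) and f(m+1,n) + f(m,n+1) = 4 f(m,n), which determine f
-- by induction on n.  For the factorial ratio, after clearing denominators this is the identity
-- (m+1)(2n+2)(2n+1) = 4(m+1)(n+1)(m+n+1) - (n+1)(2m+2)(2m+1); along the way it shows that the
-- division defining S is exact.  For LDLᵀ, Pascal's rule applied twice gives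
-- L(m+1,k) = L(m,k-1) + 2 L(m,k) + L(m,k+1), with L(m,-1) = L(m,1) by symmetry of the central row.
-- After this substitution the defect of the recurrence telescopes under the alternating weights D,
-- leaving a boundary term that vanishes because L(m,k) = 0 for k > m.

open import Defs
open import Relation.Binary.PropositionalEquality
  using (_≡_; _≗_; refl; sym; trans; cong; cong₂; subst; module ≡-Reasoning)
open ≡-Reasoning

module _ where
  open import Data.Nat using (ℕ; suc; _+_; _*_; _∸_; _!; _≤_; _<_; NonZero)
  open import Data.Nat.Properties
    using (+-suc; +-identityʳ; +-comm; *-suc; *-assoc; *-identityʳ; m+n∸m≡n; m≤m+n; +-monoʳ-<;
           m*n≢0; _!≢0; _!*_!≢0)
  open import Data.Nat.Combinatorics
    using (_C_; nCk+nC[k+1]≡[n+1]C[k+1]; nCk≡nC[n∸k]; k![n∸k]!∣n!)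
  open import Data.Nat.Combinatorics.Specification using (nCk≡n!/k![n-k]!; k>n⇒nCk≡0)
  open import Data.Nat.DivMod using (_/_; m/n*n≡m)
  open import Data.Nat.Tactic.RingSolver using (solve-∀)

  nCk*k![n∸k]!≡n! : ∀ {n k} → k ≤ n → (n C k) * (k ! * (n ∸ k) !) ≡ n !
  nCk*k![n∸k]!≡n! {n} {k} k≤n = begin
    (n C k) * (k ! * (n ∸ k) !)
      ≡⟨ cong (_* (k ! * (n ∸ k) !)) (nCk≡n!/k![n-k]! k≤n) ⟩
    n ! / (k ! * (n ∸ k) !) * (k ! * (n ∸ k) !)
      ≡⟨ m/n*n≡m (k![n∸k]!∣n! k≤n) ⟩
    n ! ∎
    where
    instance
      k![n∸k]!≢0 : NonZero (k ! * (n ∸ k) !)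
      k![n∸k]!≢0 = k !* (n ∸ k) !≢0

  pascal-twice : ∀ n k → suc (suc n) C suc (suc k) ≡ n C k + 2 * (n C suc k) + n C suc (suc k)
  pascal-twice n k = begin
    suc (suc n) C suc (suc k)
      ≡⟨ pascal (suc n) (suc k) ⟨
    suc n C suc k + suc n C suc (suc k)
      ≡⟨ cong₂ _+_ (pascal n k) (pascal n (suc k)) ⟨
    (n C k + n C suc k) + (n C suc k + n C suc (suc k))
      ≡⟨ regroup (n C k) (n C suc k) (n C suc (suc k)) ⟩
    n C k + 2 * (n C suc k) + n C suc (suc k) ∎
    where
    pascal : ∀ n k → n C k + n C suc k ≡ suc n C suc k
    pascal = nCk+nC[k+1]≡[n+1]C[k+1]
    regroup : ∀ a b c → (a + b) + (b + c) ≡ a + 2 * b + c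
    regroup = solve-∀

  central-row-suc : ∀ m k →
    (2 * suc m) C (suc m + suc k)
      ≡ (2 * m) C (m + k) + 2 * ((2 * m) C (m + suc k)) + (2 * m) C (m + suc (suc k))
  central-row-suc m k = begin
    (2 * suc m) C (suc m + suc k)          ≡⟨ cong₂ _C_ (*-suc 2 m) (cong suc m+1+k) ⟩
    suc (suc (2 * m)) C suc (suc (m + k))  ≡⟨ pascal-twice (2 * m) (m + k) ⟩
    (2 * m) C (m + k) + 2 * ((2 * m) C suc (m + k)) + (2 * m) C suc (suc (m + k))
      ≡⟨ cong₂ (λ i j → (2 * m) C (m + k) + 2 * ((2 * m) C i) + (2 * m) C j) m+1+k m+2+k ⟨
    (2 * m) C (m + k) + 2 * ((2 * m) C (m + suc k)) + (2 * m) C (m + suc (suc k)) ∎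
    where
    m+1+k : m + suc k ≡ suc (m + k)
    m+1+k = +-suc m k
    m+2+k : m + suc (suc k) ≡ suc (suc (m + k))
    m+2+k = trans (+-suc m (suc k)) (cong suc m+1+k)

  central-row-zero : ∀ m →
    (2 * suc m) C (suc m + 0) ≡ 2 * ((2 * m) C (m + 0)) + 2 * ((2 * m) C (m + 1))
  central-row-zero m = begin
    (2 * suc m) C (suc m + 0)                    ≡⟨ cong₂ _C_ (*-suc 2 m) (+-identityʳ (suc m)) ⟩
    suc (suc n) C suc m                          ≡⟨ pascal (suc n) m ⟨
    suc n C m + suc n C suc m                    ≡⟨ cong (_+ suc n C suc m) odd-row-symmetric ⟩
    suc n C suc m + suc n C suc m                ≡⟨ cong₂ _+_ (pascal n m) (pascal n m) ⟨
    (n C m + n C suc m) + (n C m + n C suc m)    ≡⟨ double (n C m) (n C suc m) ⟩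
    2 * (n C m) + 2 * (n C suc m)
      ≡⟨ cong₂ (λ i j → 2 * (n C i) + 2 * (n C j)) (+-identityʳ m) (+-comm m 1) ⟨
    2 * (n C (m + 0)) + 2 * (n C (m + 1))        ∎
    where
    n : ℕ
    n = 2 * m
    pascal : ∀ n k → n C k + n C suc k ≡ suc n C suc k
    pascal = nCk+nC[k+1]≡[n+1]C[k+1]
    double : ∀ a b → (a + b) + (a + b) ≡ 2 * a + 2 * b
    double = solve-∀
    1+2m≡m+[1+m] : ∀ m → suc (2 * m) ≡ m + suc m
    1+2m≡m+[1+m] = solve-∀
    m≤1+n : m ≤ suc n
    m≤1+n = subst (m ≤_) (sym (1+2m≡m+[1+m] m)) (m≤m+n m (suc m))
    odd-row-symmetric : suc n C m ≡ suc n C suc m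
    odd-row-symmetric = begin
      suc n C m               ≡⟨ nCk≡nC[n∸k] m≤1+n ⟩
      suc n C (suc n ∸ m)     ≡⟨ cong (λ j → suc n C (j ∸ m)) (1+2m≡m+[1+m] m) ⟩
      suc n C (m + suc m ∸ m) ≡⟨ cong (suc n C_) (m+n∸m≡n m (suc m)) ⟩
      suc n C suc m           ∎

  central-row-vanish : ∀ {m k} → m < k → (2 * m) C (m + k) ≡ 0
  central-row-vanish {m} {k} m<k =
    k>n⇒nCk≡0 (subst (_< m + k) (cong (m +_) (sym (+-identityʳ m))) (+-monoʳ-< m m<k))

  denominator numerator : ℕ → ℕ → ℕ
  denominator m n = m ! * n ! * (m + n) !
  numerator m n = (2 * m) ! * (2 * n) !

  denominator-sucˡ : ∀ m n → denominator (suc m) n ≡ suc m * suc (m + n) * denominator m n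
  denominator-sucˡ m n = regroup (suc m) (suc (m + n)) (m !) (n !) ((m + n) !)
    where
    regroup : ∀ x y a b c → x * a * b * (y * c) ≡ x * y * (a * b * c)
    regroup = solve-∀

  denominator-sucʳ : ∀ m n → denominator m (suc n) ≡ suc n * suc (m + n) * denominator m n
  denominator-sucʳ m n = begin
    m ! * (suc n * n !) * (m + suc n) !
      ≡⟨ cong (λ j → m ! * (suc n * n !) * j !) (+-suc m n) ⟩
    m ! * (suc n * n !) * suc (m + n) !
      ≡⟨ regroup (suc n) (suc (m + n)) (m !) (n !) ((m + n) !) ⟩
    suc n * suc (m + n) * denominator m n ∎
    where
    regroup : ∀ x y a b c → a * (x * b) * (y * c) ≡ x * y * (a * b * c)
    regroup = solve-∀

  [2+2m]! : ∀ m → (2 * suc m) ! ≡ (2 + 2 * m) * (1 + 2 * m) * (2 * m) !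
  [2+2m]! m = trans (cong _! (*-suc 2 m)) (sym (*-assoc (2 + 2 * m) (1 + 2 * m) ((2 * m) !)))

  numerator-sucˡ : ∀ m n → numerator (suc m) n ≡ (2 + 2 * m) * (1 + 2 * m) * numerator m n
  numerator-sucˡ m n =
    trans (cong (_* (2 * n) !) ([2+2m]! m)) (*-assoc ((2 + 2 * m) * (1 + 2 * m)) ((2 * m) !) ((2 * n) !))

  numerator-sucʳ : ∀ m n → numerator m (suc n) ≡ (2 + 2 * n) * (1 + 2 * n) * numerator m n
  numerator-sucʳ m n =
    trans (cong ((2 * m) ! *_) ([2+2m]! n)) (regroup ((2 + 2 * n) * (1 + 2 * n)) ((2 * m) !) ((2 * n) !))
    where
    regroup : ∀ x a b → a * (x * b) ≡ x * (a * b)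
    regroup = solve-∀

  denominator-nonZero : ∀ m n → NonZero (denominator m n)
  denominator-nonZero m n = m*n≢0 (m ! * n !) ((m + n) !) {{m !* n !≢0}} {{(m + n) !≢0}}

  central-binomial-ratio : ∀ m → ((2 * m) C m) * denominator m 0 ≡ numerator m 0
  central-binomial-ratio m = begin
    ((2 * m) C m) * (m ! * 1 * (m + 0) !)
      ≡⟨ cong₂ (λ x j → ((2 * m) C m) * (x * j !))
               (*-identityʳ (m !)) (sym (m+n∸m≡n m (m + 0))) ⟩
    ((2 * m) C m) * (m ! * (2 * m ∸ m) !) ≡⟨ nCk*k![n∸k]!≡n! (m≤m+n m (m + 0)) ⟩
    (2 * m) !                             ≡⟨ *-identityʳ ((2 * m) !) ⟨
    numerator m 0                         ∎

module _ where
  open import Data.Nat as ℕ using (ℕ; zero; suc; pred; _<_; NonZero)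
  import Data.Nat.Properties as ℕₚ
  open import Data.Nat.Combinatorics using (_C_)
  open import Data.Nat.DivMod using (_/_; m*n/n≡m)
  open import Data.Integer using (ℤ; +_; -[1+_]; _+_; _-_; _*_; -1ℤ; _^_)
  open import Data.Integer.Properties
    using (pos-*; +-injective; *-cancelˡ-≡; *-zeroʳ; *-distribˡ-+; +-commutativeSemigroup)
  open import Algebra.Properties.CommutativeSemigroup +-commutativeSemigroup using (interchange)
  open import Data.Integer.Tactic.RingSolver using (solve-∀)

  sumTo-cong : ∀ N {f g : ℕ → ℤ} → f ≗ g → sumTo N f ≡ sumTo N g
  sumTo-cong zero    f≗g = refl
  sumTo-cong (suc N) f≗g = cong₂ _+_ (sumTo-cong N f≗g) (f≗g N)

  sumTo-distrib-+ : ∀ N (f g : ℕ → ℤ) → sumTo N (λ k → f k + g k) ≡ sumTo N f + sumTo N g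
  sumTo-distrib-+ zero    f g = refl
  sumTo-distrib-+ (suc N) f g =
    trans (cong (_+ (f N + g N)) (sumTo-distrib-+ N f g))
          (interchange (sumTo N f) (sumTo N g) (f N) (g N))

  sumTo-distribˡ-* : ∀ N c (f : ℕ → ℤ) → sumTo N (λ k → c * f k) ≡ c * sumTo N f
  sumTo-distribˡ-* zero    c f = sym (*-zeroʳ c)
  sumTo-distribˡ-* (suc N) c f =
    trans (cong (_+ c * f N) (sumTo-distribˡ-* N c f)) (sym (*-distribˡ-+ c (sumTo N f) (f N)))

  sumTo-D-telescope : ∀ (c : ℕ → ℤ) K →
    sumTo (suc K) (λ k → D k * (c (pred k) + c k)) ≡ + 2 * (-1ℤ ^ K) * c K
  sumTo-D-telescope c zero = first (c 0)
    where
    first : ∀ x → + 0 + + 1 * (x + x) ≡ + 2 * + 1 * x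
    first = solve-∀
  sumTo-D-telescope c (suc K) = begin
    sumTo (suc K) (λ k → D k * (c (pred k) + c k)) + D (suc K) * (c K + c (suc K))
      ≡⟨ cong (_+ D (suc K) * (c K + c (suc K))) (sumTo-D-telescope c K) ⟩
    + 2 * (-1ℤ ^ K) * c K + (-1ℤ * -1ℤ ^ K) * + 2 * (c K + c (suc K))
      ≡⟨ cancel (-1ℤ ^ K) (c K) (c (suc K)) ⟩
    + 2 * (-1ℤ * -1ℤ ^ K) * c (suc K) ∎
    where
    cancel : ∀ s x y → + 2 * s * x + (-1ℤ * s) * + 2 * (x + y) ≡ + 2 * (-1ℤ * s) * y
    cancel = solve-∀

  innerD : ℕ → (ℕ → ℤ) → (ℕ → ℤ) → ℤ
  innerD N a b = sumTo N (λ k → a k * D k * b k)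

  innerD-cong : ∀ N {a a′ b b′ : ℕ → ℤ} → a ≗ a′ → b ≗ b′ →
                innerD N a b ≡ innerD N a′ b′
  innerD-cong N a≗a′ b≗b′ =
    sumTo-cong N (λ k → cong₂ (λ x y → x * D k * y) (a≗a′ k) (b≗b′ k))

  -- Pascal's rule applied twice; the clause for k = 0 uses a(-1) = a(1).
  nextRow : (ℕ → ℤ) → ℕ → ℤ
  nextRow a zero    = + 2 * a 0 + + 2 * a 1
  nextRow a (suc k) = a k + + 2 * a (suc k) + a (suc (suc k))

  cross : (ℕ → ℤ) → (ℕ → ℤ) → ℕ → ℤ
  cross a b k = a k * b (suc k) + a (suc k) * b k

  -- pred 0 = 0 makes cross a b (-1) = cross a b 0, the value forced by a(-1) = a(1), b(-1) = b(1).
  nextRow-defect : ∀ a b k →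
    nextRow a k * D k * b k + a k * D k * nextRow b k
      ≡ + 4 * (a k * D k * b k) + D k * (cross a b (pred k) + cross a b k)
  nextRow-defect a b zero = expand (a 0) (a 1) (b 0) (b 1)
    where
    expand : ∀ a₀ a₁ b₀ b₁ →
      (+ 2 * a₀ + + 2 * a₁) * + 1 * b₀ + a₀ * + 1 * (+ 2 * b₀ + + 2 * b₁)
        ≡ + 4 * (a₀ * + 1 * b₀) + + 1 * ((a₀ * b₁ + a₁ * b₀) + (a₀ * b₁ + a₁ * b₀))
    expand = solve-∀
  nextRow-defect a b (suc k) =
    expand (D (suc k)) (a k) (a (suc k)) (a (suc (suc k))) (b k) (b (suc k)) (b (suc (suc k)))
    where
    expand : ∀ d a₀ a₁ a₂ b₀ b₁ b₂ →
      (a₀ + + 2 * a₁ + a₂) * d * b₁ + a₁ * d * (b₀ + + 2 * b₁ + b₂)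
        ≡ + 4 * (a₁ * d * b₁) + d * ((a₀ * b₁ + a₁ * b₀) + (a₁ * b₂ + a₂ * b₁))
    expand = solve-∀

  innerD-nextRow : ∀ K a b →
    innerD (suc K) (nextRow a) b + innerD (suc K) a (nextRow b)
      ≡ + 4 * innerD (suc K) a b + + 2 * (-1ℤ ^ K) * cross a b K
  innerD-nextRow K a b = begin
    innerD (suc K) (nextRow a) b + innerD (suc K) a (nextRow b)
      ≡⟨ sumTo-distrib-+ (suc K) _ _ ⟨
    sumTo (suc K) (λ k → nextRow a k * D k * b k + a k * D k * nextRow b k)
      ≡⟨ sumTo-cong (suc K) (nextRow-defect a b) ⟩
    sumTo (suc K) (λ k → + 4 * (a k * D k * b k) + D k * (cross a b (pred k) + cross a b k))
      ≡⟨ sumTo-distrib-+ (suc K) _ _ ⟩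
    sumTo (suc K) (λ k → + 4 * (a k * D k * b k))
      + sumTo (suc K) (λ k → D k * (cross a b (pred k) + cross a b k))
      ≡⟨ cong₂ _+_ (sumTo-distribˡ-* (suc K) (+ 4) _) (sumTo-D-telescope (cross a b) K) ⟩
    + 4 * innerD (suc K) a b + + 2 * (-1ℤ ^ K) * cross a b K ∎

  L-suc : ∀ m → L (suc m) ≗ nextRow (L m)
  L-suc m zero    =
    trans (cong +_ (central-row-zero m))
          (cong₂ _+_ (pos-* 2 ((2 ℕ.* m) C (m ℕ.+ 0))) (pos-* 2 ((2 ℕ.* m) C (m ℕ.+ 1))))
  L-suc m (suc k) =
    trans (cong +_ (central-row-suc m k))
          (cong (λ x → L m k + x + L m (suc (suc k))) (pos-* 2 ((2 ℕ.* m) C (m ℕ.+ suc k))))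

  L-vanish : ∀ {m k} → m < k → L m k ≡ + 0
  L-vanish m<k = cong +_ (central-row-vanish m<k)

  innerD-L0 : ∀ N a → innerD (suc N) a (L 0) ≡ a 0
  innerD-L0 zero a = unit (a 0)
    where
    unit : ∀ x → + 0 + x * + 1 * + 1 ≡ x
    unit = solve-∀
  innerD-L0 (suc N) a =
    trans (cong₂ (λ s t → s + a (suc N) * D (suc N) * t)
                 (innerD-L0 N a) (L-vanish {0} {suc N} (ℕ.s≤s ℕ.z≤n)))
          (drop (a 0) (a (suc N) * D (suc N)))
    where
    drop : ∀ x y → x + y * + 0 ≡ x
    drop = solve-∀

  LDLᵀ : ℕ → ℕ → ℤ
  LDLᵀ m n = innerD (suc (m ℕ.+ n)) (L m) (L n)

  LDLᵀ-base : ∀ m → LDLᵀ m 0 ≡ + ((2 ℕ.* m) C m)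
  LDLᵀ-base m =
    trans (innerD-L0 (m ℕ.+ 0) (L m)) (cong (λ k → + ((2 ℕ.* m) C k)) (ℕₚ.+-identityʳ m))

  LDLᵀ-rec : ∀ m n → LDLᵀ (suc m) n + LDLᵀ m (suc n) ≡ + 4 * LDLᵀ m n
  LDLᵀ-rec m n = begin
    LDLᵀ (suc m) n + LDLᵀ m (suc n)
      ≡⟨ cong₂ _+_ (innerD-cong (suc K) (L-suc m) (λ _ → refl)) shift ⟩
    innerD (suc K) (nextRow a) b + innerD (suc K) a (nextRow b)
      ≡⟨ innerD-nextRow K a b ⟩
    + 4 * (LDLᵀ m n + a K * D K * b K) + + 2 * (-1ℤ ^ K) * (a K * b (suc K) + a (suc K) * b K)
      ≡⟨ cong₂ (λ x y → + 4 * (LDLᵀ m n + x * D K * b K)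
                          + + 2 * (-1ℤ ^ K) * (x * b (suc K) + y * b K))
               (L-vanish m<K) (L-vanish (ℕₚ.m<n⇒m<1+n m<K)) ⟩
    + 4 * (LDLᵀ m n + + 0 * D K * b K) + + 2 * (-1ℤ ^ K) * (+ 0 * b (suc K) + + 0 * b K)
      ≡⟨ drop (LDLᵀ m n) (D K) (b K) (b (suc K)) (-1ℤ ^ K) ⟩
    + 4 * LDLᵀ m n ∎
    where
    K : ℕ
    K = suc (m ℕ.+ n)
    a b : ℕ → ℤ
    a = L m
    b = L n
    m<K : m < K
    m<K = ℕ.s≤s (ℕₚ.m≤m+n m n)
    shift : LDLᵀ m (suc n) ≡ innerD (suc K) a (nextRow b)
    shift = trans (cong (λ N → innerD (suc N) a (L (suc n))) (ℕₚ.+-suc m n))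
                  (innerD-cong (suc K) {a} (λ _ → refl) (L-suc n))
    drop : ∀ x d y y′ s → + 4 * (x + + 0 * d * y) + + 2 * s * (+ 0 * y′ + + 0 * y) ≡ + 4 * x
    drop = solve-∀

  pos-*³ : ∀ x y z → + (x ℕ.* y ℕ.* z) ≡ + x * + y * + z
  pos-*³ x y z = trans (pos-* (x ℕ.* y) z) (cong (_* + z) (pos-* x y))

  pos-denominator-sucˡ : ∀ m n →
    + denominator (suc m) n ≡ (+ 1 + + m) * (+ 1 + (+ m + + n)) * + denominator m n
  pos-denominator-sucˡ m n =
    trans (cong +_ (denominator-sucˡ m n)) (pos-*³ (suc m) (suc (m ℕ.+ n)) (denominator m n))

  pos-denominator-sucʳ : ∀ m n →
    + denominator m (suc n) ≡ (+ 1 + + n) * (+ 1 + (+ m + + n)) * + denominator m n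
  pos-denominator-sucʳ m n =
    trans (cong +_ (denominator-sucʳ m n)) (pos-*³ (suc n) (suc (m ℕ.+ n)) (denominator m n))

  pos-[2+2m][1+2m] : ∀ m x → + ((2 ℕ.+ 2 ℕ.* m) ℕ.* (1 ℕ.+ 2 ℕ.* m) ℕ.* x)
                               ≡ (+ 2 + + 2 * + m) * (+ 1 + + 2 * + m) * + x
  pos-[2+2m][1+2m] m x = trans (pos-*³ (2 ℕ.+ 2 ℕ.* m) (1 ℕ.+ 2 ℕ.* m) x)
                               (cong (λ t → (+ 2 + t) * (+ 1 + t) * + x) (pos-* 2 m))

  pos-numerator-sucˡ : ∀ m n →
    + numerator (suc m) n ≡ (+ 2 + + 2 * + m) * (+ 1 + + 2 * + m) * + numerator m n
  pos-numerator-sucˡ m n = trans (cong +_ (numerator-sucˡ m n)) (pos-[2+2m][1+2m] m (numerator m n))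

  pos-numerator-sucʳ : ∀ m n →
    + numerator m (suc n) ≡ (+ 2 + + 2 * + n) * (+ 1 + + 2 * + n) * + numerator m n
  pos-numerator-sucʳ m n = trans (cong +_ (numerator-sucʳ m n)) (pos-[2+2m][1+2m] n (numerator m n))

  superCatalan-step : ∀ m n (a b c : ℤ) → b + c ≡ + 4 * a →
    a * + denominator m n ≡ + numerator m n →
    b * + denominator (suc m) n ≡ + numerator (suc m) n →
    c * + denominator m (suc n) ≡ + numerator m (suc n)
  superCatalan-step m n a b c b+c≡4a a-ratio b-ratio = *-cancelˡ-≡ (+ suc m) _ _ (begin
    + suc m * (c * + denominator m (suc n))
      ≡⟨ cong₂ (λ x y → + suc m * (x * y)) c≡4a-b (pos-denominator-sucʳ m n) ⟩
    (+ 1 + M) * ((+ 4 * a - b) * ((+ 1 + N) * (+ 1 + (M + N)) * p))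
      ≡⟨ expand M N a b p ⟩
    (+ 1 + N) * (+ 4 * (+ 1 + M) * (+ 1 + (M + N)) * (a * p) - b * ((+ 1 + M) * (+ 1 + (M + N)) * p))
      ≡⟨ cong₂ (λ x y → (+ 1 + N) * (+ 4 * (+ 1 + M) * (+ 1 + (M + N)) * x - y))
               a-ratio b-ratio′ ⟩
    (+ 1 + N) * (+ 4 * (+ 1 + M) * (+ 1 + (M + N)) * q - (+ 2 + + 2 * M) * (+ 1 + + 2 * M) * q)
      ≡⟨ collect M N q ⟩
    (+ 1 + M) * ((+ 2 + + 2 * N) * (+ 1 + + 2 * N) * q)
      ≡⟨ cong (+ suc m *_) (pos-numerator-sucʳ m n) ⟨
    + suc m * + numerator m (suc n) ∎)
    where
    M N p q : ℤ
    M = + m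
    N = + n
    p = + denominator m n
    q = + numerator m n
    y≡[x+y]-x : ∀ x y → y ≡ x + y - x
    y≡[x+y]-x = solve-∀
    c≡4a-b : c ≡ + 4 * a - b
    c≡4a-b = trans (y≡[x+y]-x b c) (cong (_- b) b+c≡4a)
    b-ratio′ : b * ((+ 1 + M) * (+ 1 + (M + N)) * p) ≡ (+ 2 + + 2 * M) * (+ 1 + + 2 * M) * q
    b-ratio′ = begin
      b * ((+ 1 + M) * (+ 1 + (M + N)) * p) ≡⟨ cong (b *_) (pos-denominator-sucˡ m n) ⟨
      b * + denominator (suc m) n           ≡⟨ b-ratio ⟩
      + numerator (suc m) n                 ≡⟨ pos-numerator-sucˡ m n ⟩
      (+ 2 + + 2 * M) * (+ 1 + + 2 * M) * q ∎
    expand : ∀ M N a b p →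
      (+ 1 + M) * ((+ 4 * a - b) * ((+ 1 + N) * (+ 1 + (M + N)) * p))
        ≡ (+ 1 + N) * (+ 4 * (+ 1 + M) * (+ 1 + (M + N)) * (a * p)
                       - b * ((+ 1 + M) * (+ 1 + (M + N)) * p))
    expand = solve-∀
    collect : ∀ M N q →
      (+ 1 + N) * (+ 4 * (+ 1 + M) * (+ 1 + (M + N)) * q - (+ 2 + + 2 * M) * (+ 1 + + 2 * M) * q)
        ≡ (+ 1 + M) * ((+ 2 + + 2 * N) * (+ 1 + + 2 * N) * q)
    collect = solve-∀

  i*n≡m⇒m/n≡i : ∀ {i m n} .{{_ : NonZero n}} → i * + n ≡ + m → + (m / n) ≡ i
  i*n≡m⇒m/n≡i {+ k}      {m} {n}     i*n≡m =
    cong +_ (trans (cong (_/ n) (sym (+-injective (trans (pos-* k n) i*n≡m)))) (m*n/n≡m k n))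
  i*n≡m⇒m/n≡i { -[1+ k ]} {m} {suc n} ()

  module _ (f : ℕ → ℕ → ℤ)
           (f-base : ∀ m → f m 0 ≡ + ((2 ℕ.* m) C m))
           (f-rec : ∀ m n → f (suc m) n + f m (suc n) ≡ + 4 * f m n) where

    f*denominator≡numerator : ∀ n m → f m n * + denominator m n ≡ + numerator m n
    f*denominator≡numerator zero m = begin
      f m 0 * + denominator m 0              ≡⟨ cong (_* + denominator m 0) (f-base m) ⟩
      + ((2 ℕ.* m) C m) * + denominator m 0  ≡⟨ pos-* ((2 ℕ.* m) C m) (denominator m 0) ⟨
      + (((2 ℕ.* m) C m) ℕ.* denominator m 0) ≡⟨ cong +_ (central-binomial-ratio m) ⟩
      + numerator m 0                        ∎
    f*denominator≡numerator (suc n) m =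
      superCatalan-step m n (f m n) (f (suc m) n) (f m (suc n)) (f-rec m n)
                        (f*denominator≡numerator n m) (f*denominator≡numerator n (suc m))

    S≡solution : ∀ m n → + S m n ≡ f m n
    S≡solution m n = i*n≡m⇒m/n≡i {{denominator-nonZero m n}} (f*denominator≡numerator n m)

open import Data.Nat using (ℕ; suc; _+_)
open import Data.Integer using (ℤ; +_; _*_)

mainTheorem1 : (m n : ℕ) →
    + (S m n) ≡ sumTo (suc (m + n)) (λ k → L m k * D k * L n k)
mainTheorem1 = S≡solution LDLᵀ LDLᵀ-base LDLᵀ-rec
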